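{- Let $\beta$ be a totally positive quadratic integer with minimal polynomial $x^2 - Ex + C$, where $E, C \in \mathbb{Z}_{\geq 1}$, and let $n \in \mathbb{Z}_{\geq 0}$. If $E\beta^n = a_j\beta^j + \dots + a_1\beta + a_0$ with $j, a_i \in \mathbb{Z}_{\geq 0}$, $a_j \neq 0$, is a partition different from the partition $E\beta^n$ itself (i.e. the polynomial $a_jx^j+\dots+a_0$ differs from $Ex^n$), then $j = n+1$ and $a_{n+1} = 1$, i.e. the partition is of the form $E\beta^n = \beta^{n+1} + a_n\beta^n + \dots + a_1\beta + a_0$ with $a_i \in \mathbb{Z}_{\geq 0}$.
   Context: A quadratic integer is a root of a monic irreducible quadratic polynomial over $\mathbb{Z}$. A real quadratic $\beta$ with conjugate $\beta'$ is totally positive if $\beta > 0$ and $\beta' > 0$. -}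

module Defs where

open import Data.Nat as ℕ using (ℕ; zero; suc)
open import Data.Integer as ℤ using (ℤ; +_)
open import Data.Fin using (Fin; toℕ; zero; suc)
open import Data.Product using (Σ; _×_; _,_)
open import Relation.Binary.PropositionalEquality using (_≡_)
open import Relation.Nullary using (¬_)

-- The monic quadratic x² - E x + C (E, C natural numbers) is irreducible
-- over ℤ: it admits no factorisation (a x + b)(c x + d) into two linear
-- integer polynomials (a factorisation into non-units of a monic quadratic
-- over ℤ must be of this shape).
IrreducibleQuad : ℕ → ℕ → Set
IrreducibleQuad E C =
  ¬ (Σ ℤ λ a → Σ ℤ λ b → Σ ℤ λ c → Σ ℤ λ d →
       (a ℤ.* c ≡ + 1) × (a ℤ.* d ℤ.+ b ℤ.* c ≡ ℤ.- (+ E)) × (b ℤ.* d ≡ + C))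

-- Elements of ℤ[β] ≅ ℤ[x]/(x² - E x + C), written u + v β as the pair (u , v).
-- Since β is irrational, {1, β} is a ℤ-basis, so equality in ℤ[β] ⊂ ℝ is
-- equality of pairs.
Zβ : Set
Zβ = ℤ × ℤ

module _ (E C : ℕ) where

  -- multiplication by β, using β² = E β - C
  mulβ : Zβ → Zβ
  mulβ (u , v) = (ℤ.- (v ℤ.* + C) , u ℤ.+ v ℤ.* + E)

  powβ : ℕ → Zβ
  powβ zero    = (+ 1 , + 0)
  powβ (suc n) = mulβ (powβ n)

addZβ : Zβ → Zβ → Zβ
addZβ (u , v) (u' , v') = (u ℤ.+ u' , v ℤ.+ v')

scaleZβ : ℕ → Zβ → Zβ
scaleZβ k (u , v) = (+ k ℤ.* u , + k ℤ.* v)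

sumFin : (m : ℕ) → (Fin m → Zβ) → Zβ
sumFin zero    f = (+ 0 , + 0)
sumFin (suc m) f = addZβ (f zero) (sumFin m (λ i → f (suc i)))

evalβ : (E C j : ℕ) → (Fin (suc j) → ℕ) → Zβ
evalβ E C j a = sumFin (suc j) (λ i → scaleZβ (a i) (powβ E C (toℕ i)))

monoCoeff : ℕ → ℕ → ℕ → ℕ
monoCoeff E n i with i ℕ.≟ n
... | Relation.Nullary.yes _ = E
... | Relation.Nullary.no  _ = 0

-- Compare both sides of E βⁿ = Σ aᵢ βⁱ under integer linear functionals on
-- ℤ[β] = ℤ ⊕ ℤβ. For a functional l, shift l is the functional with
-- (shift l)(β z) = C · l(z). Hence (shiftⁿ l)(βⁱ) = Cⁱ · (shiftⁿ⁻ⁱ l)(1) for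
-- i ≤ n and (shiftⁿ l)(βⁱ) = Cⁿ · l(βⁱ⁻ⁿ) for i ≥ n, and both sequences
-- k ↦ (shiftᵏ l)(1) and k ↦ l(βᵏ) satisfy x_{k+2} = E x_{k+1} − C x_k.
-- When E² > 4C (hence E ≥ 3, as C ≥ 1) such a sequence stays nonnegative and
-- nondecreasing as soon as x₀ ≥ 0 and x₁/x₀ ≥ (E − 1)/2.
--
-- For ψ(u + vβ) = −v, shiftⁿ ψ vanishes at βⁿ and is positive at all lower
-- powers; as every aᵢ ≥ 0 this kills all aᵢ with i < n when j ≤ n. For
-- φ(u + vβ) = 2u + (E + 1)v, shiftⁿ φ is nonnegative on all powers of β and
-- takes the value 2ECⁿ on E βⁿ, Cⁿ(E + 1) at βⁿ⁺¹ and more than 2ECⁿ at every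
-- higher power. This determines aₙ = E when j = n, and forces j = n + 1 and
-- aⱼ = 1 when j > n.

{-# OPTIONS --safe #-}
module Submission where

module Partitions where
  open import Defs
  open import Data.Nat.Base as ℕ using (ℕ; zero; suc; z≤n; s≤s)
  import Data.Nat.Properties as ℕₚ
  open import Data.Integer.Base
    using ( ℤ; +_; 0ℤ; 1ℤ; -1ℤ; _+_; _-_; -_; _*_; _^_; _≤_; _<_; +≤+; +<+
          ; positive; nonNegative; ≢-nonZero)
  open import Data.Integer.Properties
  open import Data.Integer.Tactic.RingSolver using (solve-∀)
  open import Algebra.Properties.CommutativeMonoid.Sum +-0-commutativeMonoid
    using (sum; sum-cong-≗; sum-init-last; sum-replicate-zero)
  open import Data.Fin.Base using (Fin; zero; suc; toℕ; fromℕ; inject₁)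
  open import Data.Fin.Properties using (toℕ-fromℕ; toℕ-injective; toℕ-inject₁; toℕ<n; toℕ≤pred[n])
  open import Data.Vec.Functional using (Vector; init)
  open import Data.Product.Base using (_×_; _,_; proj₁; proj₂)
  open import Data.Sum.Base using (inj₁; inj₂)
  open import Data.Empty using (⊥-elim)
  open import Function.Base using (_∘_)
  open import Relation.Binary.PropositionalEquality
  open import Relation.Nullary using (¬_; yes; no)

  0≤i*j : ∀ {i j} → 0ℤ ≤ i → 0ℤ ≤ j → 0ℤ ≤ i * j
  0≤i*j {i} 0≤i 0≤j = subst (_≤ i * _) (*-zeroʳ i) (*-monoˡ-≤-nonNeg i {{nonNegative 0≤i}} 0≤j)

  0<i*j : ∀ {i j} → 0ℤ < i → 0ℤ < j → 0ℤ < i * j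
  0<i*j {i} 0<i 0<j = subst (_< i * _) (*-zeroʳ i) (*-monoˡ-<-pos i {{positive 0<i}} 0<j)

  0≤k*i⇒0≤i : ∀ {k i} → 0ℤ < k → 0ℤ ≤ k * i → 0ℤ ≤ i
  0≤k*i⇒0≤i {k} {i} 0<k 0≤ki =
    *-cancelˡ-≤-pos 0ℤ i k {{positive 0<k}} (subst (_≤ k * i) (sym (*-zeroʳ k)) 0≤ki)

  ≤-by : ∀ {i j} k → 0ℤ ≤ k → j ≡ i + k → i ≤ j
  ≤-by {i} k 0≤k refl = i≤i+j i k {{nonNegative 0≤k}}

  0≤+ : ∀ n → 0ℤ ≤ + n
  0≤+ n = +≤+ z≤n

  i≤m*i : ∀ {m i} → m ≢ 0 → 0ℤ ≤ i → i ≤ + m * i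
  i≤m*i {m} {i} m≢0 0≤i =
    subst (_≤ + m * i) (*-identityˡ i)
          (*-monoʳ-≤-nonNeg i {{nonNegative 0≤i}} (+≤+ (ℕₚ.n≢0⇒n>0 m≢0)))

  ≢0∧≱2⇒≡1 : ∀ {m} → m ≢ 0 → ¬ 2 ℕ.≤ m → m ≡ 1
  ≢0∧≱2⇒≡1 {zero}          m≢0 _   = ⊥-elim (m≢0 refl)
  ≢0∧≱2⇒≡1 {suc zero}      _   _   = refl
  ≢0∧≱2⇒≡1 {suc (suc m)}   _   m≱2 = ⊥-elim (m≱2 (s≤s (s≤s z≤n)))

  sum-nonNeg : ∀ {n} (f : Vector ℤ n) → (∀ i → 0ℤ ≤ f i) → 0ℤ ≤ sum f
  sum-nonNeg {zero}  f 0≤f = ≤-refl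
  sum-nonNeg {suc n} f 0≤f = +-mono-≤ (0≤f zero) (sum-nonNeg (f ∘ suc) (0≤f ∘ suc))

  nonNeg⇒≤sum : ∀ {n} (f : Vector ℤ n) → (∀ i → 0ℤ ≤ f i) → ∀ i → f i ≤ sum f
  nonNeg⇒≤sum f 0≤f zero    = i≤i+j (f zero) _ {{nonNegative (sum-nonNeg (f ∘ suc) (0≤f ∘ suc))}}
  nonNeg⇒≤sum f 0≤f (suc i) =
    ≤-trans (nonNeg⇒≤sum (f ∘ suc) (0≤f ∘ suc) i) (i≤j+i _ (f zero) {{nonNegative (0≤f zero)}})

  module LinearRecurrence
    (e c : ℤ) (x : ℕ → ℤ) (x-rec : ∀ k → x (suc (suc k)) ≡ e * x (suc k) - c * x k)
    {p q : ℤ} (0≤p : 0ℤ ≤ p) (0<q : 0ℤ < q) (p≤qe : p ≤ q * e)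
    (qqc+pp≤qep : q * q * c + p * p ≤ q * e * p)
    (0≤x₀ : 0ℤ ≤ x 0) (px₀≤qx₁ : p * x 0 ≤ q * x 1)
    where

    ratio-bound : ∀ k → 0ℤ ≤ x k × p * x k ≤ q * x (suc k)
    ratio-bound zero    = 0≤x₀ , px₀≤qx₁
    ratio-bound (suc k) with ratio-bound k
    ... | 0≤xₖ , pxₖ≤qxₖ₊₁ = 0≤xₖ₊₁ , 0≤i-j⇒j≤i (0≤k*i⇒0≤i 0<q 0≤q·gap)
      where
        0≤xₖ₊₁ : 0ℤ ≤ x (suc k)
        0≤xₖ₊₁ = 0≤k*i⇒0≤i 0<q (≤-trans (0≤i*j 0≤p 0≤xₖ) pxₖ≤qxₖ₊₁)

        -- The new gap q xₖ₊₂ − p xₖ₊₁ is a nonnegative combination of the old gap and xₖ.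
        gap-identity : ∀ e c p q x₀ x₁ →
          q * (q * (e * x₁ - c * x₀) - p * x₁)
            ≡ (q * e - p) * (q * x₁ - p * x₀) + (q * e * p - (q * q * c + p * p)) * x₀
        gap-identity = solve-∀

        0≤q·gap : 0ℤ ≤ q * (q * x (suc (suc k)) - p * x (suc k))
        0≤q·gap = subst (0ℤ ≤_)
          (sym (trans (cong (λ y → q * (q * y - p * x (suc k))) (x-rec k))
                      (gap-identity e c p q (x k) (x (suc k)))))
          (+-mono-≤ (0≤i*j (i≤j⇒0≤j-i p≤qe) (i≤j⇒0≤j-i pxₖ≤qxₖ₊₁))
                    (0≤i*j (i≤j⇒0≤j-i qqc+pp≤qep) 0≤xₖ))

    nonNeg : ∀ k → 0ℤ ≤ x k
    nonNeg = proj₁ ∘ ratio-bound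

    module _ (q≤p : q ≤ p) where

      x-step : ∀ k → x k ≤ x (suc k)
      x-step k = *-cancelˡ-≤-pos (x k) (x (suc k)) q {{positive 0<q}}
        (≤-trans (*-monoʳ-≤-nonNeg (x k) {{nonNegative (nonNeg k)}} q≤p) (proj₂ (ratio-bound k)))

      nondecreasing : ∀ {i k} → i ℕ.≤ k → x i ≤ x k
      nondecreasing = nondecreasing′ ∘ ℕₚ.≤⇒≤′
        where
          nondecreasing′ : ∀ {i k} → i ℕ.≤′ k → x i ≤ x k
          nondecreasing′ ℕ.≤′-refl        = ≤-refl
          nondecreasing′ (ℕ.≤′-step i≤′k) = ≤-trans (nondecreasing′ i≤′k) (x-step _)

  module Functionals (E C : ℕ) where
    e c : ℤ
    e = + E
    c = + C

    β^_ : ℕ → Zβ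
    β^_ = powβ E C

    Functional : Set
    Functional = ℤ × ℤ

    infix 8 _⟨_⟩
    _⟨_⟩ : Functional → Zβ → ℤ
    (α , γ) ⟨ u , v ⟩ = α * u + γ * v

    shift : Functional → Functional
    shift (α , γ) = (e * α - γ , c * α)

    shiftⁿ : ℕ → Functional → Functional
    shiftⁿ zero    l = l
    shiftⁿ (suc n) l = shift (shiftⁿ n l)

    shift-mulβ : ∀ l z → shift l ⟨ mulβ E C z ⟩ ≡ c * l ⟨ z ⟩
    shift-mulβ (α , γ) (u , v) = identity e c α γ u v
      where
        identity : ∀ e c α γ u v →
          (e * α - γ) * - (v * c) + c * α * (u + v * e) ≡ c * (α * u + γ * v)
        identity = solve-∀

    ⟨⟩-mulβ² : ∀ l z → l ⟨ mulβ E C (mulβ E C z) ⟩ ≡ e * l ⟨ mulβ E C z ⟩ - c * l ⟨ z ⟩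
    ⟨⟩-mulβ² (α , γ) (u , v) = identity e c α γ u v
      where
        identity : ∀ e c α γ u v →
          α * - ((u + v * e) * c) + γ * (- (v * c) + (u + v * e) * e)
            ≡ e * (α * - (v * c) + γ * (u + v * e)) - c * (α * u + γ * v)
        identity = solve-∀

    shiftⁿ-β^-+ˡ : ∀ l k m → shiftⁿ (k ℕ.+ m) l ⟨ β^ k ⟩ ≡ c ^ k * proj₁ (shiftⁿ m l)
    shiftⁿ-β^-+ˡ l zero m = identity (proj₁ (shiftⁿ m l)) (proj₂ (shiftⁿ m l))
      where
        identity : ∀ α γ → α * + 1 + γ * + 0 ≡ 1ℤ * α
        identity = solve-∀
    shiftⁿ-β^-+ˡ l (suc k) m = begin
      shift (shiftⁿ (k ℕ.+ m) l) ⟨ mulβ E C (β^ k) ⟩ ≡⟨ shift-mulβ (shiftⁿ (k ℕ.+ m) l) (β^ k) ⟩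
      c * shiftⁿ (k ℕ.+ m) l ⟨ β^ k ⟩              ≡⟨ cong (c *_) (shiftⁿ-β^-+ˡ l k m) ⟩
      c * (c ^ k * proj₁ (shiftⁿ m l))              ≡⟨ *-assoc c (c ^ k) _ ⟨
      c ^ suc k * proj₁ (shiftⁿ m l)                ∎
      where open ≡-Reasoning

    shiftⁿ-β^-+ʳ : ∀ l n k → shiftⁿ n l ⟨ β^ (n ℕ.+ k) ⟩ ≡ c ^ n * l ⟨ β^ k ⟩
    shiftⁿ-β^-+ʳ l zero    k = sym (*-identityˡ _)
    shiftⁿ-β^-+ʳ l (suc n) k = begin
      shift (shiftⁿ n l) ⟨ mulβ E C (β^ (n ℕ.+ k)) ⟩ ≡⟨ shift-mulβ (shiftⁿ n l) (β^ (n ℕ.+ k)) ⟩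
      c * shiftⁿ n l ⟨ β^ (n ℕ.+ k) ⟩              ≡⟨ cong (c *_) (shiftⁿ-β^-+ʳ l n k) ⟩
      c * (c ^ n * l ⟨ β^ k ⟩)                     ≡⟨ *-assoc c (c ^ n) _ ⟨
      c ^ suc n * l ⟨ β^ k ⟩                       ∎
      where open ≡-Reasoning

    shiftⁿ-β^-≤ : ∀ l {i n} → i ℕ.≤ n →
                  shiftⁿ n l ⟨ β^ i ⟩ ≡ c ^ i * proj₁ (shiftⁿ (n ℕ.∸ i) l)
    shiftⁿ-β^-≤ l {i} {n} i≤n =
      subst (λ m → shiftⁿ m l ⟨ β^ i ⟩ ≡ c ^ i * proj₁ (shiftⁿ (n ℕ.∸ i) l))
            (ℕₚ.m+[n∸m]≡n i≤n) (shiftⁿ-β^-+ˡ l i (n ℕ.∸ i))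

    shiftⁿ-β^-≥ : ∀ l {i n} → n ℕ.≤ i →
                  shiftⁿ n l ⟨ β^ i ⟩ ≡ c ^ n * l ⟨ β^ (i ℕ.∸ n) ⟩
    shiftⁿ-β^-≥ l {i} {n} n≤i =
      subst (λ m → shiftⁿ n l ⟨ β^ m ⟩ ≡ c ^ n * l ⟨ β^ (i ℕ.∸ n) ⟩)
            (ℕₚ.m+[n∸m]≡n n≤i) (shiftⁿ-β^-+ʳ l n (i ℕ.∸ n))

    shiftⁿ-β^-self : ∀ l n → shiftⁿ n l ⟨ β^ n ⟩ ≡ c ^ n * proj₁ l
    shiftⁿ-β^-self l n =
      trans (shiftⁿ-β^-≤ l {n} ℕₚ.≤-refl)
            (cong (λ m → c ^ n * proj₁ (shiftⁿ m l)) (ℕₚ.n∸n≡0 n))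

    ⟨⟩-scaleZβ : ∀ l k z → l ⟨ scaleZβ k z ⟩ ≡ + k * l ⟨ z ⟩
    ⟨⟩-scaleZβ (α , γ) k (u , v) = identity α γ (+ k) u v
      where
        identity : ∀ α γ k u v → α * (k * u) + γ * (k * v) ≡ k * (α * u + γ * v)
        identity = solve-∀

    ⟨⟩-sumFin : ∀ l m (f : Fin m → Zβ) → l ⟨ sumFin m f ⟩ ≡ sum (λ i → l ⟨ f i ⟩)
    ⟨⟩-sumFin (α , γ) zero    f = cong₂ _+_ (*-zeroʳ α) (*-zeroʳ γ)
    ⟨⟩-sumFin l       (suc m) f =
      trans (identity (proj₁ l) (proj₂ l) (proj₁ (f zero)) (proj₂ (f zero)) _ _)
            (cong (l ⟨ f zero ⟩ +_) (⟨⟩-sumFin l m (f ∘ suc)))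
      where
        identity : ∀ α γ u v u′ v′ →
          α * (u + u′) + γ * (v + v′) ≡ (α * u + γ * v) + (α * u′ + γ * v′)
        identity = solve-∀

    ⟨⟩-evalβ : ∀ l j (a : Fin (suc j) → ℕ) →
               l ⟨ evalβ E C j a ⟩ ≡ sum (λ i → + a i * l ⟨ β^ toℕ i ⟩)
    ⟨⟩-evalβ l j a = trans (⟨⟩-sumFin l (suc j) (λ i → scaleZβ (a i) (β^ toℕ i)))
                           (sum-cong-≗ (λ i → ⟨⟩-scaleZβ l (a i) (β^ toℕ i)))

  module Partition (E C : ℕ) (1≤C : 1 ℕ.≤ C) (4C<E² : 4 ℕ.* C ℕ.< E ℕ.* E) where
    open Functionals E C

    0<c : 0ℤ < c
    0<c = +<+ 1≤C

    0<c^ : ∀ k → 0ℤ < c ^ k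
    0<c^ zero    = +<+ (s≤s z≤n)
    0<c^ (suc k) = 0<i*j 0<c (0<c^ k)

    3≤E : 3 ℕ.≤ E
    3≤E = E≥3 E (ℕₚ.≤-<-trans (ℕₚ.*-monoʳ-≤ 4 1≤C) 4C<E²)
      where
        E≥3 : ∀ E → 4 ℕ.< E ℕ.* E → 3 ℕ.≤ E
        E≥3 0 ()
        E≥3 1 (s≤s ())
        E≥3 2 (s≤s (s≤s (s≤s (s≤s ()))))
        E≥3 (suc (suc (suc E))) _ = s≤s (s≤s (s≤s z≤n))

    0≤e-3 : 0ℤ ≤ e - + 3
    0≤e-3 = i≤j⇒0≤j-i (+≤+ 3≤E)

    0≤disc : 0ℤ ≤ e * e - (1ℤ + + 4 * c)
    0≤disc = i≤j⇒0≤j-i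
      (subst₂ (λ x y → 1ℤ + x ≤ y) (pos-* 4 C) (pos-* E E) (+≤+ 4C<E²))

    -- Every sequence below is controlled by the ratio (E − 1)/2 = p/q.
    p q : ℤ
    p = e - 1ℤ
    q = + 2

    0<q : 0ℤ < q
    0<q = +<+ (s≤s z≤n)

    q≤p : q ≤ p
    q≤p = ≤-by (e - + 3) 0≤e-3 (identity e)
      where
        identity : ∀ e → e - 1ℤ ≡ + 2 + (e - + 3)
        identity = solve-∀

    0≤p : 0ℤ ≤ p
    0≤p = ≤-trans (0≤+ 2) q≤p

    p≤qe : p ≤ q * e
    p≤qe = ≤-by (e - + 3 + + 4) (+-mono-≤ 0≤e-3 (0≤+ 4)) (identity e)
      where
        identity : ∀ e → + 2 * e ≡ e - 1ℤ + (e - + 3 + + 4)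
        identity = solve-∀

    qqc+pp≤qep : q * q * c + p * p ≤ q * e * p
    qqc+pp≤qep = ≤-by _ 0≤disc (identity e c)
      where
        identity : ∀ e c → + 2 * e * (e - 1ℤ)
          ≡ + 2 * + 2 * c + (e - 1ℤ) * (e - 1ℤ) + (e * e - (1ℤ + + 4 * c))
        identity = solve-∀

    module RatioBound (x : ℕ → ℤ) (x-rec : ∀ k → x (suc (suc k)) ≡ e * x (suc k) - c * x k) =
      LinearRecurrence e c x x-rec 0≤p 0<q p≤qe qqc+pp≤qep

    -- (shiftᵏ ψ)(1) and (shiftᵏ φ)(1) are the Lucas sequences U_k and V_k − U_k
    -- of (E, C), and φ(βᵏ) = V_k + U_k.
    ψ φ : Functional
    ψ = (0ℤ , -1ℤ)
    φ = (+ 2 , e + 1ℤ)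

    ψ-start : p * proj₁ ψ ≤ q * proj₁ (shift ψ)
    ψ-start = ≤-by (+ 2) (0≤+ 2) (identity e)
      where
        identity : ∀ e → + 2 * (e * 0ℤ - -1ℤ) ≡ (e - 1ℤ) * 0ℤ + + 2
        identity = solve-∀

    φ-start : p * proj₁ φ ≤ q * proj₁ (shift φ)
    φ-start = ≤-reflexive (identity e)
      where
        identity : ∀ e → (e - 1ℤ) * + 2 ≡ + 2 * (e * + 2 - (e + 1ℤ))
        identity = solve-∀

    0<U₁ : 0ℤ < proj₁ (shift ψ)
    0<U₁ = subst (0ℤ <_) (sym (identity e)) (+<+ (s≤s z≤n))
      where
        identity : ∀ e → e * 0ℤ - -1ℤ ≡ 1ℤ
        identity = solve-∀

    module U = RatioBound (λ k → proj₁ (shiftⁿ k ψ)) (λ _ → refl) ≤-refl ψ-start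
    module G = RatioBound (λ k → proj₁ (shiftⁿ k φ)) (λ _ → refl) (0≤+ 2) φ-start

    φ⟨1⟩ : φ ⟨ β^ 0 ⟩ ≡ + 2
    φ⟨1⟩ = identity e
      where
        identity : ∀ e → + 2 * + 1 + (e + 1ℤ) * + 0 ≡ + 2
        identity = solve-∀

    φ⟨β⟩ : φ ⟨ β^ 1 ⟩ ≡ e + 1ℤ
    φ⟨β⟩ = identity e c
      where
        identity : ∀ e c → + 2 * - (+ 0 * c) + (e + 1ℤ) * (+ 1 + + 0 * e) ≡ e + 1ℤ
        identity = solve-∀

    φ⟨β^⟩-start : p * φ ⟨ β^ 0 ⟩ ≤ q * φ ⟨ β^ 1 ⟩
    φ⟨β^⟩-start =
      subst₂ (λ x y → p * x ≤ q * y) (sym φ⟨1⟩) (sym φ⟨β⟩) (≤-by (+ 4) (0≤+ 4) (identity e))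
      where
        identity : ∀ e → + 2 * (e + 1ℤ) ≡ (e - 1ℤ) * + 2 + + 4
        identity = solve-∀

    module H = RatioBound (λ k → φ ⟨ β^ k ⟩) (λ k → ⟨⟩-mulβ² φ (β^ k))
      (subst (0ℤ ≤_) (sym φ⟨1⟩) (0≤+ 2)) φ⟨β^⟩-start

    φ⟨β²⟩ : φ ⟨ β^ 2 ⟩ ≡ e * (e + 1ℤ) - c * + 2
    φ⟨β²⟩ = trans (⟨⟩-mulβ² φ (β^ 0)) (cong₂ (λ x y → e * x - c * y) φ⟨β⟩ φ⟨1⟩)

    2e<φ⟨β²⟩ : + 2 * e < φ ⟨ β^ 2 ⟩
    2e<φ⟨β²⟩ = suc[i]≤j⇒i<j (subst (1ℤ + + 2 * e ≤_) (sym φ⟨β²⟩)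
      (*-cancelˡ-≤-pos _ _ q {{positive 0<q}} (≤-by _ 0≤gap (identity e c))))
      where
        identity : ∀ e c → + 2 * (e * (e + 1ℤ) - c * + 2)
          ≡ + 2 * (1ℤ + + 2 * e)
            + ((e * e - (1ℤ + + 4 * c)) + ((e - + 3) * (e - + 3) + ((e - + 3) * + 4 + + 2)))
        identity = solve-∀

        0≤gap : 0ℤ ≤ (e * e - (1ℤ + + 4 * c)) + ((e - + 3) * (e - + 3) + ((e - + 3) * + 4 + + 2))
        0≤gap = +-mono-≤ 0≤disc
          (+-mono-≤ (0≤i*j 0≤e-3 0≤e-3) (+-mono-≤ (0≤i*j 0≤e-3 (0≤+ 4)) (0≤+ 2)))

    2e<φ⟨β^⟩ : ∀ {k} → 2 ℕ.≤ k → + 2 * e < φ ⟨ β^ k ⟩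
    2e<φ⟨β^⟩ 2≤k = <-≤-trans 2e<φ⟨β²⟩ (H.nondecreasing q≤p 2≤k)

    shiftⁿψ-nonNeg : ∀ {i n} → i ℕ.≤ n → 0ℤ ≤ shiftⁿ n ψ ⟨ β^ i ⟩
    shiftⁿψ-nonNeg {i} {n} i≤n =
      subst (0ℤ ≤_) (sym (shiftⁿ-β^-≤ ψ i≤n)) (0≤i*j (<⇒≤ (0<c^ i)) (U.nonNeg (n ℕ.∸ i)))

    shiftⁿψ-pos : ∀ {i n} → i ℕ.< n → 0ℤ < shiftⁿ n ψ ⟨ β^ i ⟩
    shiftⁿψ-pos {i} i<n = subst (0ℤ <_) (sym (shiftⁿ-β^-≤ ψ (ℕₚ.<⇒≤ i<n)))
      (0<i*j (0<c^ i) (<-≤-trans 0<U₁ (U.nondecreasing q≤p (ℕₚ.m<n⇒0<n∸m i<n))))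

    shiftⁿφ-nonNeg : ∀ n i → 0ℤ ≤ shiftⁿ n φ ⟨ β^ i ⟩
    shiftⁿφ-nonNeg n i with ℕₚ.≤-total i n
    ... | inj₁ i≤n =
      subst (0ℤ ≤_) (sym (shiftⁿ-β^-≤ φ i≤n)) (0≤i*j (<⇒≤ (0<c^ i)) (G.nonNeg (n ℕ.∸ i)))
    ... | inj₂ n≤i =
      subst (0ℤ ≤_) (sym (shiftⁿ-β^-≥ φ n≤i)) (0≤i*j (<⇒≤ (0<c^ n)) (H.nonNeg (i ℕ.∸ n)))

    module PartitionOfEβⁿ
      (n : ℕ) {j} (a : Fin (suc j) → ℕ) (eval≡ : evalβ E C j a ≡ scaleZβ E (β^ n))
      where

      terms : Functional → Vector ℤ (suc j)
      terms l i = + a i * shiftⁿ n l ⟨ β^ toℕ i ⟩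

      sum-terms : ∀ l → sum (terms l) ≡ e * (c ^ n * proj₁ l)
      sum-terms l = begin
        sum (terms l)                       ≡⟨ ⟨⟩-evalβ (shiftⁿ n l) j a ⟨
        shiftⁿ n l ⟨ evalβ E C j a ⟩        ≡⟨ cong (shiftⁿ n l ⟨_⟩) eval≡ ⟩
        shiftⁿ n l ⟨ scaleZβ E (β^ n) ⟩     ≡⟨ ⟨⟩-scaleZβ (shiftⁿ n l) E (β^ n) ⟩
        e * shiftⁿ n l ⟨ β^ n ⟩             ≡⟨ cong (e *_) (shiftⁿ-β^-self l n) ⟩
        e * (c ^ n * proj₁ l)               ∎
        where open ≡-Reasoning

      leading-term : ∀ l → terms l (fromℕ j) ≡ + a (fromℕ j) * shiftⁿ n l ⟨ β^ j ⟩
      leading-term l = cong (λ m → + a (fromℕ j) * shiftⁿ n l ⟨ β^ m ⟩) (toℕ-fromℕ j)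

      low-coefficients-vanish : j ℕ.≤ n → ∀ i → toℕ i ℕ.< n → a i ≡ 0
      low-coefficients-vanish j≤n i i<n with i*j≡0⇒i≡0∨j≡0 (+ a i) termᵢ≡0
        where
          0≤terms : ∀ i → 0ℤ ≤ terms ψ i
          0≤terms i = 0≤i*j (0≤+ (a i)) (shiftⁿψ-nonNeg (ℕₚ.≤-trans (toℕ≤pred[n] i) j≤n))

          sum≡0 : sum (terms ψ) ≡ 0ℤ
          sum≡0 = trans (sum-terms ψ) (trans (cong (e *_) (*-zeroʳ (c ^ n))) (*-zeroʳ e))

          termᵢ≡0 : terms ψ i ≡ 0ℤ
          termᵢ≡0 = ≤-antisym (subst (terms ψ i ≤_) sum≡0 (nonNeg⇒≤sum _ 0≤terms i)) (0≤terms i)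
      ... | inj₁ aᵢ≡0 = +-injective aᵢ≡0
      ... | inj₂ ψᵢ≡0 = ⊥-elim (<⇒≢ (shiftⁿψ-pos i<n) (sym ψᵢ≡0))

      top-coefficient : j ≡ n → a (fromℕ j) ≡ E
      top-coefficient refl = +-injective (*-cancelʳ-≡ _ _ w {{≢-nonZero (<⇒≢ 0<w ∘ sym)}} (begin
        + a (fromℕ n) * w                          ≡⟨ cong (+ a (fromℕ n) *_) (shiftⁿ-β^-self φ n) ⟨
        + a (fromℕ n) * shiftⁿ n φ ⟨ β^ n ⟩        ≡⟨ leading-term φ ⟨
        terms φ (fromℕ n)                          ≡⟨ +-identityˡ _ ⟨
        0ℤ + terms φ (fromℕ n)                     ≡⟨ cong (_+ terms φ (fromℕ n)) sum-init≡0 ⟨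
        sum (init (terms φ)) + terms φ (fromℕ n)   ≡⟨ sum-init-last (terms φ) ⟨
        sum (terms φ)                              ≡⟨ sum-terms φ ⟩
        e * w                                      ∎))
        where
          open ≡-Reasoning
          w = c ^ n * + 2

          0<w : 0ℤ < w
          0<w = 0<i*j (0<c^ n) 0<q

          init-term≡0 : ∀ i → init (terms φ) i ≡ 0ℤ
          init-term≡0 i = trans (cong (λ m → + m * value) aᵢ≡0) (*-zeroˡ value)
            where
              value = shiftⁿ n φ ⟨ β^ toℕ (inject₁ i) ⟩
              aᵢ≡0 = low-coefficients-vanish ℕₚ.≤-refl (inject₁ i)
                (subst (ℕ._< n) (sym (toℕ-inject₁ i)) (toℕ<n i))

          sum-init≡0 : sum (init (terms φ)) ≡ 0ℤ
          sum-init≡0 = trans (sum-cong-≗ init-term≡0) (sum-replicate-zero n)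

      degree-below : j ℕ.< n → a (fromℕ j) ≡ 0
      degree-below j<n =
        low-coefficients-vanish (ℕₚ.<⇒≤ j<n) (fromℕ j) (subst (ℕ._< n) (sym (toℕ-fromℕ j)) j<n)

      coefficients-of-Eβⁿ : j ≡ n → (i : Fin (suc j)) → a i ≡ monoCoeff E n (toℕ i)
      coefficients-of-Eβⁿ refl i with toℕ i ℕₚ.≟ n
      ... | yes toℕi≡n =
        trans (cong a (toℕ-injective (trans toℕi≡n (sym (toℕ-fromℕ n))))) (top-coefficient refl)
      ... | no  toℕi≢n =
        low-coefficients-vanish ℕₚ.≤-refl i (ℕₚ.≤∧≢⇒< (toℕ≤pred[n] i) toℕi≢n)

      leading-bound : n ℕ.≤ j → + a (fromℕ j) * φ ⟨ β^ (j ℕ.∸ n) ⟩ ≤ + 2 * e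
      leading-bound n≤j = *-cancelˡ-≤-pos _ _ (c ^ n) {{positive (0<c^ n)}} (begin
        c ^ n * (+ a (fromℕ j) * φ ⟨ β^ (j ℕ.∸ n) ⟩) ≡⟨ swap (c ^ n) (+ a (fromℕ j)) _ ⟩
        + a (fromℕ j) * (c ^ n * φ ⟨ β^ (j ℕ.∸ n) ⟩) ≡⟨ cong (+ a (fromℕ j) *_) (shiftⁿ-β^-≥ φ n≤j) ⟨
        + a (fromℕ j) * shiftⁿ n φ ⟨ β^ j ⟩          ≡⟨ leading-term φ ⟨
        terms φ (fromℕ j)                            ≤⟨ nonNeg⇒≤sum (terms φ) 0≤terms (fromℕ j) ⟩
        sum (terms φ)                                ≡⟨ sum-terms φ ⟩
        e * (c ^ n * + 2)                            ≡⟨ swap e (c ^ n) (+ 2) ⟩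
        c ^ n * (e * + 2)                            ≡⟨ cong (c ^ n *_) (*-comm e (+ 2)) ⟩
        c ^ n * (+ 2 * e)                            ∎)
        where
          open ≤-Reasoning

          0≤terms : ∀ i → 0ℤ ≤ terms φ i
          0≤terms i = 0≤i*j (0≤+ (a i)) (shiftⁿφ-nonNeg n (toℕ i))

          swap : ∀ x y z → x * (y * z) ≡ y * (x * z)
          swap = solve-∀

      degree-above : n ℕ.< j → a (fromℕ j) ≢ 0 → j ≡ suc n × a (fromℕ j) ≡ 1
      degree-above n<j aⱼ≢0 = j≡1+n , ≢0∧≱2⇒≡1 aⱼ≢0 aⱼ≱2
        where
          bound : + a (fromℕ j) * φ ⟨ β^ (j ℕ.∸ n) ⟩ ≤ + 2 * e
          bound = leading-bound (ℕₚ.<⇒≤ n<j)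

          j∸n≡1 : j ℕ.∸ n ≡ 1
          j∸n≡1 = ≢0∧≱2⇒≡1 (ℕₚ.m<n⇒n≢0 (ℕₚ.m<n⇒0<n∸m n<j)) λ 2≤j∸n →
            <⇒≱ (2e<φ⟨β^⟩ 2≤j∸n) (≤-trans (i≤m*i aⱼ≢0 (H.nonNeg (j ℕ.∸ n))) bound)

          j≡1+n : j ≡ suc n
          j≡1+n = trans (sym (ℕₚ.m∸n+n≡m (ℕₚ.<⇒≤ n<j))) (cong (ℕ._+ n) j∸n≡1)

          aⱼ≱2 : ¬ 2 ℕ.≤ a (fromℕ j)
          aⱼ≱2 2≤aⱼ = <⇒≱ (<-≤-trans 2e<2[e+1] (*-monoʳ-≤-nonNeg (e + 1ℤ) (+≤+ 2≤aⱼ)))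
            (subst (λ x → + a (fromℕ j) * x ≤ + 2 * e)
                   (trans (cong (λ k → φ ⟨ β^ k ⟩) j∸n≡1) φ⟨β⟩) bound)
            where
              identity : ∀ e → + 2 * (e + 1ℤ) ≡ 1ℤ + + 2 * e + 1ℤ
              identity = solve-∀

              2e<2[e+1] : + 2 * e < + 2 * (e + 1ℤ)
              2e<2[e+1] = suc[i]≤j⇒i<j (≤-by 1ℤ (0≤+ 1) (identity e))

open import Defs
open import Data.Nat using (ℕ; suc; _≤_; _<_; _*_)
open import Data.Fin using (Fin; toℕ; fromℕ)
open import Data.Product using (_×_; _,_)
open import Relation.Binary.PropositionalEquality using (_≡_; _≢_)
open import Relation.Nullary using (¬_)
open import Data.Nat.Properties using (<-cmp)
open import Data.Empty using (⊥-elim)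
open import Relation.Binary.Definitions using (Tri; tri<; tri≈; tri>)

-- Irreducibility only justifies identifying ℤ[β] with ℤ × ℤ, which Defs
-- already does; the argument itself needs just C ≥ 1 and E² > 4C.
lemma10 : (E C : ℕ) → 1 ≤ E → 1 ≤ C
    → IrreducibleQuad E C
    → 4 * C < E * E
    → (n j : ℕ) (a : Fin (suc j) → ℕ)
    → a (fromℕ j) ≢ 0
    → evalβ E C j a ≡ scaleZβ E (powβ E C n)
    → ¬ (j ≡ n × ((i : Fin (suc j)) → a i ≡ monoCoeff E n (toℕ i)))
    → (j ≡ suc n) × (a (fromℕ j) ≡ 1)
lemma10 E C _ 1≤C _ 4C<E² n j a aⱼ≢0 eval≡ a≢Eβⁿ = by-degree (<-cmp j n)
  where
    open Partitions.Partition E C 1≤C 4C<E²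
    open PartitionOfEβⁿ n a eval≡

    by-degree : Tri (j < n) (j ≡ n) (n < j) → (j ≡ suc n) × (a (fromℕ j) ≡ 1)
    by-degree (tri< j<n _ _) = ⊥-elim (aⱼ≢0 (degree-below j<n))
    by-degree (tri≈ _ j≡n _) = ⊥-elim (a≢Eβⁿ (j≡n , coefficients-of-Eβⁿ j≡n))
    by-degree (tri> _ _ n<j) = degree-above n<j aⱼ≢0
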